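{- Let $D$ be a digraph. The following are equivalent: (1) $D$ has no directed cycles; (2) $D$ has Kelly-width $1$; (3) $\overrightarrow{\nu}(D)=0$.
   Context: Digraphs are finite, without loops or parallel arcs; a digraph $D=(V,A)$ has vertex set $V=\{1,\dots,n\}$. $Q(D)$ is the set of real $n\times n$ matrices $B=[b_{u,w}]$ with $b_{u,u}\neq 0$ for all $u$, $b_{u,w}\neq 0$ if $u\neq w$ and there is an arc from $u$ to $w$, and $b_{u,w}=0$ if $u\neq w$ and there is no arc from $u$ to $w$. A matrix $B\in Q(D)$ has the Asymmetric Strong Arnold Property (ASAP) if the only real $n\times n$ matrix $X$ with $X\circ B=0$ (entrywise product), $X^TB=0$ and $BX^T=0$ is $X=0$. $\overrightarrow{\nu}(D)$ is the largest nullity of a matrix $B\in Q(D)$ having the ASAP. Kelly-width: for a DAG $T$ and nodes $i,j$, write $i\preceq j$ if $i=j$ or there is a directed walk from $i$ to $j$. For $W,X\subseteq V(D)$, $X$ guards $W$ if $W\cap X=\emptyset$ and for every arc $uv$ of $D$ with $u\in W$ we have $v\in W\cup X$. A Kelly-decomposition of $D$ is a triple $(T,\{W_i\}_{i\in V(T)},\{X_i\}_{i\in V(T)})$ with $T$ a DAG, $W_i,X_i\subseteq V(D)$, such that $\{W_i\}$ partitions $V(D)$; for every node $i$, $X_i$ guards $W_{\succeq i}:=\bigcup_{j:\, i\preceq j}W_j$; for each node $i$ its children can be enumerated $j_1,\dots,j_s$ with $X_{j_q}\subseteq W_i\cup X_i\cup\bigcup_{p<q}W_{\succeq j_p}$;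 and the roots of $T$ can be enumerated $r_1,r_2,\dots$ with $X_{r_q}\subseteq\bigcup_{p<q}W_{\succeq r_p}$. Its width is $\max_i|W_i\cup X_i|$, and the Kelly-width of $D$ is the minimum width of a Kelly-decomposition of $D$. -}

module Defs where

open import Level using (0ℓ)
open import Data.Nat using (ℕ; zero; suc; _≤_; _⊔_)
open import Data.Fin using (Fin; zero; suc)
open import Data.Fin.Subset using (Subset; _∈_; _∪_; ∣_∣)
open import Data.Bool using (Bool; true; false)
open import Data.List using (List; []; _∷_)
open import Data.List.Relation.Unary.Unique.Propositional using (Unique)
import Data.List.Membership.Propositional as LM
open import Data.Product using (Σ; ∃; _×_; _,_)
open import Data.Sum using (_⊎_)
open import Data.Unit using (⊤)
open import Data.Empty using (⊥)
open import Relation.Nullary using (¬_)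
open import Relation.Binary.PropositionalEquality using (_≡_; _≢_)
open import Relation.Binary.Structures using (IsTotalOrder)
open import Relation.Binary.Construct.Closure.ReflexiveTransitive using (Star)
open import Algebra.Bundles using (CommutativeRing)

-- The real numbers, axiomatised as a Dedekind-complete ordered field
-- (unique up to isomorphism).  The agda standard library has no reals.

record RealNumbers : Set₁ where
  field
    realRing : CommutativeRing 0ℓ 0ℓ
  open CommutativeRing realRing public
  field
    _≤ℝ_        : Carrier → Carrier → Set
    isTotalOrder : IsTotalOrder _≈_ _≤ℝ_
    0≉1          : ¬ (0# ≈ 1#)
    inverse      : ∀ x → ¬ (x ≈ 0#) → ∃ λ y → x * y ≈ 1#
    +-mono       : ∀ x y z → x ≤ℝ y → (x + z) ≤ℝ (y + z)
    *-nonneg     : ∀ x y → 0# ≤ℝ x → 0# ≤ℝ y → 0# ≤ℝ (x * y)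
    complete     : (P : Carrier → Set) → (∃ λ x → P x) →
                   (∃ λ b → ∀ x → P x → x ≤ℝ b) →
                   ∃ λ s → (∀ x → P x → x ≤ℝ s) ×
                           (∀ b → (∀ x → P x → x ≤ℝ b) → s ≤ℝ b)

record Digraph : Set where
  field
    n        : ℕ
    arc      : Fin n → Fin n → Bool
    loopless : ∀ u → arc u u ≡ false
open Digraph public

Walk : ∀ {m} → (Fin m → Fin m → Bool) → List (Fin m) → Set
Walk E []            = ⊤
Walk E (v ∷ [])      = ⊤
Walk E (v ∷ w ∷ ws)  = (E v w ≡ true) × Walk E (w ∷ ws)

lastOf : ∀ {A : Set} → A → List A → A
lastOf v []       = v
lastOf v (w ∷ ws) = lastOf w ws

HasDirectedCycle : ∀ {m} → (Fin m → Fin m → Bool) → Set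
HasDirectedCycle {m} E =
  Σ (Fin m) λ v → Σ (List (Fin m)) λ vs →
    Unique (v ∷ vs) × Walk E (v ∷ vs) × (E (lastOf v vs) v ≡ true)

Acyclic : Digraph → Set
Acyclic D = ¬ HasDirectedCycle (arc D)

Guards : (D : Digraph) → (Fin (n D) → Set) → Subset (n D) → Set
Guards D W X =
  (∀ v → W v → ¬ (v ∈ X)) ×
  (∀ u v → W u → arc D u v ≡ true → W v ⊎ v ∈ X)

maxFin : ∀ {m} → (Fin m → ℕ) → ℕ
maxFin {zero}  f = 0
maxFin {suc m} f = f zero ⊔ maxFin (λ i → f (suc i))

-- the condition on an enumeration j₁, …, jₛ:
-- X_{j_q} ⊆ base ∪ ⋃_{p<q} W_{⪰ j_p}
GoodEnum : ∀ {m k} → (Fin k → Set) → (Fin m → Subset k) →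
           (Fin m → Fin k → Set) → List (Fin m) → Set
GoodEnum base X W≽ []       = ⊤
GoodEnum base X W≽ (j ∷ js) =
  (∀ v → v ∈ X j → base v) ×
  GoodEnum (λ v → base v ⊎ W≽ j v) X W≽ js

record KellyDecomposition (D : Digraph) : Set where
  field
    m     : ℕ
    arcT  : Fin m → Fin m → Bool
    dag   : ¬ HasDirectedCycle arcT
    W     : Fin m → Subset (n D)
    X     : Fin m → Subset (n D)

  _⪯_ : Fin m → Fin m → Set
  i ⪯ j = Star (λ a b → arcT a b ≡ true) i j

  W≽ : Fin m → Fin (n D) → Set
  W≽ i v = ∃ λ j → i ⪯ j × v ∈ W j

  field
    W-nonempty : ∀ i → ∃ λ v → v ∈ W i
    W-cover    : ∀ v → ∃ λ i → v ∈ W i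
    W-disjoint : ∀ v i j → v ∈ W i → v ∈ W j → i ≡ j
    guards     : ∀ i → Guards D (W≽ i) (X i)
    children   : ∀ i → Σ (List (Fin m)) λ js →
                   Unique js ×
                   (∀ j → arcT i j ≡ true → j LM.∈ js) ×
                   (∀ j → j LM.∈ js → arcT i j ≡ true) ×
                   GoodEnum (λ v → v ∈ W i ⊎ v ∈ X i) X W≽ js
    roots      : Σ (List (Fin m)) λ rs →
                   Unique rs ×
                   (∀ r → (∀ k → arcT k r ≡ false) → r LM.∈ rs) ×
                   (∀ r → r LM.∈ rs → ∀ k → arcT k r ≡ false) ×
                   GoodEnum (λ v → ⊥) X W≽ rs

  width : ℕ
  width = maxFin (λ i → ∣ W i ∪ X i ∣)

open KellyDecomposition public using (width)

KellyWidth : Digraph → ℕ → Set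
KellyWidth D k =
  (∃ λ (K : KellyDecomposition D) → width K ≡ k) ×
  (∀ (K : KellyDecomposition D) → k ≤ width K)

module Matrices (ℝ : RealNumbers) where
  open RealNumbers ℝ using (Carrier; _≈_; _+_; _*_; 0#)

  Matrix : ℕ → Set
  Matrix k = Fin k → Fin k → Carrier

  sumFin : ∀ {k} → (Fin k → Carrier) → Carrier
  sumFin {zero}  f = 0#
  sumFin {suc k} f = f zero + sumFin (λ i → f (suc i))

  IsZeroMatrix : ∀ {k} → Matrix k → Set
  IsZeroMatrix M = ∀ u w → M u w ≈ 0#

  transpose : ∀ {k} → Matrix k → Matrix k
  transpose M u w = M w u

  _⊗_ : ∀ {k} → Matrix k → Matrix k → Matrix k
  (M ⊗ N) u w = sumFin (λ t → M u t * N t w)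

  _∘ₕ_ : ∀ {k} → Matrix k → Matrix k → Matrix k
  (M ∘ₕ N) u w = M u w * N u w

  InQ : (D : Digraph) → Matrix (n D) → Set
  InQ D B =
    (∀ u → ¬ (B u u ≈ 0#)) ×
    (∀ u w → u ≢ w → arc D u w ≡ true  → ¬ (B u w ≈ 0#)) ×
    (∀ u w → u ≢ w → arc D u w ≡ false → B u w ≈ 0#)

  ASAP : ∀ {k} → Matrix k → Set
  ASAP B = ∀ X → IsZeroMatrix (X ∘ₕ B) →
                 IsZeroMatrix (transpose X ⊗ B) →
                 IsZeroMatrix (B ⊗ transpose X) →
                 IsZeroMatrix X

  InKernel : ∀ {k} → Matrix k → (Fin k → Carrier) → Set
  InKernel B x = ∀ u → sumFin (λ t → B u t * x t) ≈ 0#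

  lincomb : ∀ {k d} → (Fin d → Carrier) → (Fin d → Fin k → Carrier) →
            Fin k → Carrier
  lincomb c v u = sumFin (λ i → c i * v i u)

  HasNullity : ∀ {k} → Matrix k → ℕ → Set
  HasNullity {k} B d =
    Σ (Fin d → Fin k → Carrier) λ v →
      (∀ i → InKernel B (v i)) ×
      (∀ c → (∀ u → lincomb c v u ≈ 0#) → ∀ i → c i ≈ 0#) ×
      (∀ x → InKernel B x → ∃ λ c → ∀ u → x u ≈ lincomb c v u)

  NuArrow : Digraph → ℕ → Set
  NuArrow D d =
    (∃ λ (B : Matrix (n D)) → InQ D B × ASAP B × HasNullity B d) ×
    (∀ (B : Matrix (n D)) d' → InQ D B → ASAP B → HasNullity B d' → d' ≤ d)

{-# OPTIONS --safe #-}
-- An acyclic digraph is its own Kelly-decomposition, with singleton bags and no guards. Conversely,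
-- width one forces empty guards and singleton bags, so every arc u → v of D lifts to a nonempty walk
-- in the DAG T from the bag of u to the bag of v, and a cycle of D would give a closed walk in T.
--
-- If D is acyclic, every B ∈ Q(D) is nonsingular, since Bx = 0 can be solved from the sinks
-- backwards; so every such B has the ASAP and nullity 0.
--
-- If D has a cycle through f, let R be the set of vertices from which f is reachable, A the adjacency
-- matrix and B = A − diag(d), where d(u) is the number of arcs from u into R for u ∈ R, and
-- out(u) + in(u) + 1 otherwise. The rows of B over R are balanced, so the indicator χ of R lies in
-- the kernel, while off R, and in every column, the diagonal strictly dominates. A maximum principle
-- shows that the kernel is spanned by χ and that a left-kernel vector vanishing on R is zero. For
-- the ASAP, BXᵀ = 0 makes X = cχᵀ, X ∘ B = 0 makes c vanish on R, and XᵀB = 0 puts c in the left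
-- kernel, so X = 0. Hence ν⃗(D) ≥ 1.
module Submission where

open import Defs
open import Level using (0ℓ)
open import Data.Nat as ℕ using (ℕ; zero; suc; _≤_; _⊔_; z≤n; s≤s)
import Data.Nat.Properties as ℕₚ
open import Data.Fin using (Fin; zero; suc; _≟_; fromℕ<)
import Data.Fin.Properties as Finₚ
open import Data.Fin.Subset as Subset using (Subset; ⁅_⁆; _∪_; ∣_∣)
import Data.Fin.Subset.Properties as Subsetₚ
open import Data.Bool as Bool using (Bool; true; false; if_then_else_)
open import Data.List using (List; []; _∷_; _∷ʳ_; length; lookup; filter; allFin)
open import Data.List.Properties using (length-++)
import Data.List.Relation.Unary.All as All
open import Data.List.Relation.Unary.All.Properties using (all-filter)
open import Data.List.Relation.Unary.AllPairs using ([]; _∷_)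
open import Data.List.Relation.Unary.Any using (here; there)
open import Data.List.Relation.Unary.Unique.Propositional using (Unique)
import Data.List.Relation.Unary.Unique.Propositional.Properties as Unique
open import Data.List.Membership.Propositional using (_∈_)
open import Data.List.Membership.Propositional.Properties using (∈-lookup; ∈-filter⁺; ∈-filter⁻; ∈-allFin)
open import Data.Product using (Σ; ∃; ∃₂; _×_; _,_; proj₁; proj₂)
open import Data.Sum using (_⊎_; inj₁; inj₂)
open import Data.Unit using (tt)
open import Data.Vec.Functional using (removeAt)
open import Function using (_∘_; flip)
open import Function.Bundles using (_⇔_; mk⇔)
open import Induction.WellFounded using (WellFounded; Acc; acc)
open import Relation.Nullary using (¬_; Dec; yes; no; does; contradiction)
open import Relation.Nullary.Decidable using (dec-true; dec-false; ¬?; ¬¬-excluded-middle)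
open import Relation.Unary using (Pred; Decidable)
open import Relation.Binary.Bundles using (Poset; TotalOrder)
open import Relation.Binary.Structures using (IsTotalOrder)
open import Relation.Binary.PropositionalEquality as ≡ using (_≡_; _≢_)
open import Relation.Binary.Construct.Closure.ReflexiveTransitive using (Star; ε; _◅_; _◅◅_; kleisliStar)

-- Simple paths and cycles

lookup-injective : ∀ {A : Set} {xs : List A} → Unique xs → ∀ i j → lookup xs i ≡ lookup xs j → i ≡ j
lookup-injective (_ ∷ _)  zero    zero    _  = ≡.refl
lookup-injective (x≢ ∷ _) zero    (suc j) eq = contradiction eq (All.lookup x≢ (∈-lookup j))
lookup-injective (x≢ ∷ _) (suc i) zero    eq = contradiction (≡.sym eq) (All.lookup x≢ (∈-lookup i))
lookup-injective (_ ∷ u)  (suc i) (suc j) eq = ≡.cong suc (lookup-injective u i j eq)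

Unique⇒length≤ : ∀ {m} {xs : List (Fin m)} → Unique xs → length xs ≤ m
Unique⇒length≤ {m} {xs} u with length xs ℕ.≤? m
... | yes ≤m = ≤m
... | no  ≰m with Finₚ.pigeonhole (ℕₚ.≰⇒> ≰m) (lookup xs)
...   | i , j , i<j , eq = contradiction (lookup-injective u i j eq) (Finₚ.<⇒≢ i<j)

module Walks {m : ℕ} (E : Fin m → Fin m → Bool) where
  open import Data.List.Membership.DecPropositional (_≟_ {m}) using (_∈?_)

  infix 4 _⟶_ _⇝_

  _⟶_ : Fin m → Fin m → Set
  a ⟶ b = E a b ≡ true

  _⇝_ : Fin m → Fin m → Set
  _⇝_ = Star _⟶_

  uncons : ∀ {a b} → a ⇝ b → a ≢ b → ∃ λ c → a ⟶ c × c ⇝ b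
  uncons ε        a≢a = contradiction ≡.refl a≢a
  uncons (e ◅ c⇝) _   = _ , e , c⇝

  walk⇒⇝ : ∀ v vs → Walk E (v ∷ vs) → v ⇝ lastOf v vs
  walk⇒⇝ v []       _        = ε
  walk⇒⇝ v (w ∷ ws) (e , w⇝) = e ◅ walk⇒⇝ w ws w⇝

  cycle⇒closedWalk : HasDirectedCycle E → ∃₂ λ a b → a ⟶ b × b ⇝ a
  cycle⇒closedWalk (v , []     , _ , _        , e)  = v , v , e , ε
  cycle⇒closedWalk (v , w ∷ ws , _ , (e , w⇝) , e′) = v , w , e , walk⇒⇝ w ws w⇝ ◅◅ (e′ ◅ ε)

  record SimplePath (start end : Fin m) : Set where
    constructor simplePath
    field
      rest   : List (Fin m)
      unique : Unique (start ∷ rest)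
      walk   : Walk E (start ∷ rest)
      ends   : lastOf start rest ≡ end

  size : ∀ {v a} → SimplePath v a → ℕ
  size P = length (SimplePath.rest P)

  trivialPath : ∀ v → SimplePath v v
  trivialPath v = simplePath [] (All.[] ∷ []) tt ≡.refl

  closeSuffix : ∀ {y} v vs → Unique (v ∷ vs) → Walk E (v ∷ vs) →
                lastOf v vs ⟶ y → y ∈ v ∷ vs → HasDirectedCycle E
  closeSuffix v vs       u       w        e (here ≡.refl) = v , vs , u , w , e
  closeSuffix v (w ∷ ws) (_ ∷ u) (_ , w⇝) e (there y∈)    = closeSuffix w ws u w⇝ e y∈

  private
    walk-∷ʳ : ∀ v vs {y} → Walk E (v ∷ vs) → lastOf v vs ⟶ y → Walk E (v ∷ vs ∷ʳ y)
    walk-∷ʳ v []       _         e = e , tt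
    walk-∷ʳ v (w ∷ ws) (e′ , w⇝) e = e′ , walk-∷ʳ w ws w⇝ e

    lastOf-∷ʳ : ∀ (v : Fin m) vs y → lastOf v (vs ∷ʳ y) ≡ y
    lastOf-∷ʳ v []       y = ≡.refl
    lastOf-∷ʳ v (w ∷ ws) y = lastOf-∷ʳ w ws y

  extend : ∀ {v a y} (P : SimplePath v a) → a ⟶ y →
           HasDirectedCycle E ⊎ Σ (SimplePath v y) λ Q → size Q ≡ suc (size P)
  extend {v} {y = y} (simplePath vs u w ≡.refl) e with y ∈? v ∷ vs
  ... | yes y∈ = inj₁ (closeSuffix v vs u w e y∈)
  ... | no  y∉ = inj₂ (simplePath (vs ∷ʳ y) unique′ (walk-∷ʳ v vs w e) (lastOf-∷ʳ v vs y) ,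
                       ≡.trans (length-++ vs) (ℕₚ.+-comm (length vs) 1))
    where unique′ = Unique.++⁺ u (All.[] ∷ []) λ { (y∈ , here ≡.refl) → y∉ y∈ }

  extend* : ∀ {v a b} → SimplePath v a → a ⇝ b → HasDirectedCycle E ⊎ SimplePath v b
  extend* P ε        = inj₂ P
  extend* P (e ◅ a⇝) with extend P e
  ... | inj₁ cycle   = inj₁ cycle
  ... | inj₂ (Q , _) = extend* Q a⇝

  closedWalk⇒cycle : ∀ {a b} → a ⟶ b → b ⇝ a → HasDirectedCycle E
  closedWalk⇒cycle {b = b} e b⇝a with extend* (trivialPath b) b⇝a
  ... | inj₁ cycle                        = cycle
  ... | inj₂ (simplePath vs u w ≡.refl) = closeSuffix b vs u w e (here ≡.refl)

  acyclic⇒wellFounded : ¬ HasDirectedCycle E → WellFounded (flip _⟶_)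
  acyclic⇒wellFounded acyclic b = accessible m (trivialPath b) ℕₚ.≤-refl
    where
    -- A simple path has fewer than m arcs, so the fuel k never runs out.
    accessible : ∀ k {v a} (P : SimplePath v a) → m ≤ size P ℕ.+ k → Acc (flip _⟶_) a
    accessible zero    P bound = contradiction (≡.subst (m ≤_) (ℕₚ.+-identityʳ (size P)) bound)
                                               (ℕₚ.<⇒≱ (Unique⇒length≤ (SimplePath.unique P)))
    accessible (suc k) P bound = acc λ a⟶y → next (extend P a⟶y)
      where
      next : ∀ {y} → HasDirectedCycle E ⊎ Σ (SimplePath _ y) (λ Q → size Q ≡ suc (size P)) → Acc (flip _⟶_) y
      next (inj₁ cycle)      = contradiction cycle acyclic
      next (inj₂ (Q , grow)) = accessible k Q
        (≡.subst (m ≤_) (≡.trans (ℕₚ.+-suc (size P) k) (≡.cong (ℕ._+ k) (≡.sym grow))) bound)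

-- Kelly-width

f≤maxFin : ∀ {k} (f : Fin k → ℕ) i → f i ≤ maxFin f
f≤maxFin f zero    = ℕₚ.m≤m⊔n _ _
f≤maxFin f (suc i) = ℕₚ.≤-trans (f≤maxFin (f ∘ suc) i) (ℕₚ.m≤n⊔m (f zero) _)

maxFin-const : ∀ {k} c (f : Fin (suc k) → ℕ) → (∀ i → f i ≡ c) → maxFin f ≡ c
maxFin-const {zero}  c f f≡c = ≡.trans (ℕₚ.⊔-identityʳ (f zero)) (f≡c zero)
maxFin-const {suc k} c f f≡c =
  ≡.trans (≡.cong₂ _⊔_ (f≡c zero) (maxFin-const c (f ∘ suc) (f≡c ∘ suc))) (ℕₚ.⊔-idem c)

x∈p⇒1≤∣p∣ : ∀ {k} {p : Subset k} {x} → x Subset.∈ p → 1 ≤ ∣ p ∣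
x∈p⇒1≤∣p∣ x∈p = ℕₚ.≤-trans (s≤s z≤n) (Subsetₚ.x∈p⇒∣p-x∣<∣p∣ x∈p)

∣p∣≤1⇒x≡y : ∀ {k} {p : Subset k} {x y} → ∣ p ∣ ≤ 1 → x Subset.∈ p → y Subset.∈ p → x ≡ y
∣p∣≤1⇒x≡y {x = x} {y} ∣p∣≤1 x∈p y∈p with x ≟ y
... | yes x≡y = x≡y
... | no  x≢y =
  contradiction ∣p∣≤1 (ℕₚ.<⇒≱ (ℕₚ.≤-trans (s≤s (x∈p⇒1≤∣p∣ y∈p-x)) (Subsetₚ.x∈p⇒∣p-x∣<∣p∣ x∈p)))
  where y∈p-x = Subsetₚ.x∈p∧x≢y⇒x∈p-y y∈p (x≢y ∘ ≡.sym)

goodEnum-noGuards : ∀ {k m} (base : Fin k → Set) (W≽ : Fin m → Fin k → Set) js →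
                    GoodEnum base (λ _ → Subset.⊥) W≽ js
goodEnum-noGuards base W≽ []       = tt
goodEnum-noGuards base W≽ (j ∷ js) =
  (λ v v∈⊥ → contradiction v∈⊥ Subsetₚ.∉⊥) , goodEnum-noGuards _ W≽ js

module _ (D : Digraph) where
  open Walks (arc D)
  open ≡ using (refl; sym; trans; cong; subst)
  open Subsetₚ using (∉⊥; x∈⁅x⁆; x∈⁅y⁆⇒x≡y; p⊆p∪q; q⊆p∪q)

  acyclic⇒decomposition : Acyclic D → KellyDecomposition D
  acyclic⇒decomposition acyclic = record
    { m          = n D
    ; arcT       = arc D
    ; dag        = acyclic
    ; W          = ⁅_⁆
    ; X          = λ _ → Subset.⊥
    ; W-nonempty = λ i → i , x∈⁅x⁆ i
    ; W-cover    = λ v → v , x∈⁅x⁆ v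
    ; W-disjoint = λ v i j v∈i v∈j → trans (sym (x∈⁅y⁆⇒x≡y i v∈i)) (x∈⁅y⁆⇒x≡y j v∈j)
    ; guards     = λ i → (λ _ _ → ∉⊥) , λ { u v (j , i⇝j , u∈j) u⟶v →
                     inj₁ (v , subst (i ⇝_) (sym (x∈⁅y⁆⇒x≡y j u∈j)) i⇝j ◅◅ (u⟶v ◅ ε) , x∈⁅x⁆ v) }
    ; children   = λ i → let child? = λ j → arc D i j Bool.≟ true in
                     filter child? (allFin _) , Unique.filter⁺ child? (Unique.allFin⁺ _) ,
                     (λ j i⟶j → ∈-filter⁺ child? (∈-allFin j) i⟶j) ,
                     (λ j j∈ → proj₂ (∈-filter⁻ child? {xs = allFin _} j∈)) ,
                     goodEnum-noGuards _ _ _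
    ; roots      = filter root? (allFin _) , Unique.filter⁺ root? (Unique.allFin⁺ _) ,
                   (λ r r-root → ∈-filter⁺ root? (∈-allFin r) r-root) ,
                   (λ r r∈ → proj₂ (∈-filter⁻ root? {xs = allFin _} r∈)) ,
                   goodEnum-noGuards _ _ _
    }
    where
    root? = λ r → Finₚ.all? λ k → arc D k r Bool.≟ false

  acyclic⇒width≡1 : (acyclic : Acyclic D) → 1 ≤ n D → width (acyclic⇒decomposition acyclic) ≡ 1
  acyclic⇒width≡1 _ = singletons
    where
    singletons : ∀ {k} → 1 ≤ k → maxFin {k} (λ i → ∣ ⁅ i ⁆ ∪ Subset.⊥ ∣) ≡ 1
    singletons {suc k} _ =
      maxFin-const 1 _ λ i → trans (cong ∣_∣ (Subsetₚ.∪-identityʳ ⁅ i ⁆)) (Subsetₚ.∣⁅x⁆∣≡1 {suc k} i)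

  1≤width : 1 ≤ n D → (K : KellyDecomposition D) → 1 ≤ width K
  1≤width 1≤n K =
    let i , v∈Wᵢ = KellyDecomposition.W-cover K (fromℕ< 1≤n)
    in  ℕₚ.≤-trans (x∈p⇒1≤∣p∣ (p⊆p∪q _ v∈Wᵢ)) (f≤maxFin _ i)

  width≡1⇒acyclic : (K : KellyDecomposition D) → width K ≡ 1 → Acyclic D
  width≡1⇒acyclic K width≡1 cycle =
    let a , b , a⟶b , b⇝a    = cycle⇒closedWalk cycle
        c , bagᵃ⟶c , c⇝bagᵇ = leaveBag a⟶b
    in  dag (T.closedWalk⇒cycle bagᵃ⟶c (c⇝bagᵇ ◅◅ kleisliStar bag ⟶⇒⇝ b⇝a))
    where
    open KellyDecomposition K
    module T = Walks arcT

    bag-small : ∀ i → ∣ W i ∪ X i ∣ ≤ 1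
    bag-small i = subst (∣ W i ∪ X i ∣ ≤_) width≡1 (f≤maxFin (λ j → ∣ W j ∪ X j ∣) i)

    no-guards : ∀ i v → ¬ v Subset.∈ X i
    no-guards i v v∈Xᵢ with W-nonempty i
    ... | w , w∈Wᵢ with ∣p∣≤1⇒x≡y (bag-small i) (q⊆p∪q (W i) (X i) v∈Xᵢ) (p⊆p∪q (X i) w∈Wᵢ)
    ...   | refl = proj₁ (guards i) v (i , ε , w∈Wᵢ) v∈Xᵢ

    bag : Fin (n D) → Fin m
    bag v = proj₁ (W-cover v)

    ∈bag : ∀ v → v Subset.∈ W (bag v)
    ∈bag v = proj₂ (W-cover v)

    ⟶⇒⇝ : ∀ {u v} → u ⟶ v → bag u T.⇝ bag v
    ⟶⇒⇝ {u} {v} u⟶v with proj₂ (guards (bag u)) u v (bag u , ε , ∈bag u) u⟶v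
    ... | inj₁ (j , bagᵘ⇝j , v∈Wⱼ) = subst (bag u T.⇝_) (W-disjoint v j (bag v) v∈Wⱼ (∈bag v)) bagᵘ⇝j
    ... | inj₂ v∈X                 = contradiction v∈X (no-guards (bag u) v)

    ⟶⇒bag≢ : ∀ {u v} → u ⟶ v → bag u ≢ bag v
    ⟶⇒bag≢ {u} {v} u⟶v bagᵘ≡bagᵛ
      with ∣p∣≤1⇒x≡y (bag-small (bag u)) (p⊆p∪q _ (∈bag u))
                     (p⊆p∪q _ (subst (λ i → v Subset.∈ W i) (sym bagᵘ≡bagᵛ) (∈bag v)))
    ... | refl with trans (sym u⟶v) (loopless D u)
    ...   | ()

    leaveBag : ∀ {u v} → u ⟶ v → ∃ λ c → bag u T.⟶ c × c T.⇝ bag v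
    leaveBag u⟶v = T.uncons (⟶⇒⇝ u⟶v) (⟶⇒bag≢ u⟶v)

  acyclic⇒kellyWidth≡1 : 1 ≤ n D → Acyclic D → KellyWidth D 1
  acyclic⇒kellyWidth≡1 1≤n acyclic =
    (acyclic⇒decomposition acyclic , acyclic⇒width≡1 acyclic 1≤n) , 1≤width 1≤n

  kellyWidth≡1⇒acyclic : KellyWidth D 1 → Acyclic D
  kellyWidth≡1⇒acyclic ((K , width≡1) , _) = width≡1⇒acyclic K width≡1

-- Ordered fields

module OrderedField (ℝ : RealNumbers) where
  open RealNumbers ℝ hiding (zero; _≤ℝ_)
  open RealNumbers ℝ public using () renaming (_≤ℝ_ to infix 4 _≤ℝ_)
  open IsTotalOrder isTotalOrder public using (total; antisym; isPartialOrder)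
    renaming (refl to ≤-refl; trans to ≤-trans; reflexive to ≤-reflexive)
  open import Algebra.Properties.Ring ring
    using (-0#≈0#; -‿involutive; -1*x≈-x; xyx⁻¹≈y; ⁻¹-anti-homo‿-; x[y-z]≈xy-xz; -‿distribʳ-*)
  open import Algebra.Properties.Semiring.Sum semiring public
    using (sum; sum-cong-≋; sum-replicate-zero; sum-remove; ∑-distrib-+; *-distribˡ-sum; *-distribʳ-sum)
  open import Algebra.Properties.CommutativeSemigroup +-commutativeSemigroup using (xy∙z≈zy∙x)

  poset : Poset _ _ _
  poset = record { isPartialOrder = isPartialOrder }

  open import Relation.Binary.Reasoning.PartialOrder poset public

  x≤y⇒0≤y-x : ∀ {x y} → x ≤ℝ y → 0# ≤ℝ y - x
  x≤y⇒0≤y-x {x} {y} x≤y = begin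
    0#      ≈⟨ -‿inverseʳ x ⟨
    x - x   ≤⟨ +-mono x y (- x) x≤y ⟩
    y - x   ∎

  neg-antitone : ∀ {x y} → x ≤ℝ y → - y ≤ℝ - x
  neg-antitone {x} {y} x≤y = begin
    - y          ≈⟨ +-identityˡ (- y) ⟨
    0# - y       ≤⟨ +-mono _ _ (- y) (x≤y⇒0≤y-x x≤y) ⟩
    y - x - y    ≈⟨ xyx⁻¹≈y y (- x) ⟩
    - x          ∎

  neg-reflects : ∀ {x y} → - x ≤ℝ - y → y ≤ℝ x
  neg-reflects {x} {y} -x≤-y = begin
    y        ≈⟨ -‿involutive y ⟨
    - (- y)  ≤⟨ neg-antitone -x≤-y ⟩
    - (- x)  ≈⟨ -‿involutive x ⟩
    x        ∎

  0≤-x⇒x≤0 : ∀ {x} → 0# ≤ℝ - x → x ≤ℝ 0#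
  0≤-x⇒x≤0 {x} 0≤-x = neg-reflects (begin - 0# ≈⟨ -0#≈0# ⟩ 0# ≤⟨ 0≤-x ⟩ - x ∎)

  -x≤0⇒0≤x : ∀ {x} → - x ≤ℝ 0# → 0# ≤ℝ x
  -x≤0⇒0≤x {x} -x≤0 = neg-reflects (begin - x ≤⟨ -x≤0 ⟩ 0# ≈⟨ -0#≈0# ⟨ - 0# ∎)

  0≤x⇒y≤x+y : ∀ {x} y → 0# ≤ℝ x → y ≤ℝ x + y
  0≤x⇒y≤x+y {x} y 0≤x = begin
    y       ≈⟨ +-identityˡ y ⟨
    0# + y  ≤⟨ +-mono 0# x y 0≤x ⟩
    x + y   ∎

  0≤1 : 0# ≤ℝ 1#
  0≤1 with total 0# 1#
  ... | inj₁ 0≤1 = 0≤1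
  ... | inj₂ 1≤0 = begin
    0#            ≤⟨ *-nonneg _ _ 0≤-1 0≤-1 ⟩
    - 1# * - 1#   ≈⟨ -1*x≈-x (- 1#) ⟩
    - (- 1#)      ≈⟨ -‿involutive 1# ⟩
    1#            ∎
    where 0≤-1 = begin 0# ≈⟨ -0#≈0# ⟨ - 0# ≤⟨ neg-antitone 1≤0 ⟩ - 1# ∎

  1≤x⇒x≉0 : ∀ {x} → 1# ≤ℝ x → ¬ x ≈ 0#
  1≤x⇒x≉0 {x} 1≤x x≈0 = 0≉1 (antisym 0≤1 (begin 1# ≤⟨ 1≤x ⟩ x ≈⟨ x≈0 ⟩ 0# ∎))

  x≉0⇒xy≈0⇒y≈0 : ∀ {x y} → ¬ x ≈ 0# → x * y ≈ 0# → y ≈ 0#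
  x≉0⇒xy≈0⇒y≈0 {x} {y} x≉0 xy≈0 with inverse x x≉0
  ... | x⁻¹ , xx⁻¹≈1 = begin-equality
    y              ≈⟨ *-identityˡ y ⟨
    1# * y         ≈⟨ *-congʳ (trans (sym xx⁻¹≈1) (*-comm x x⁻¹)) ⟩
    (x⁻¹ * x) * y  ≈⟨ *-assoc x⁻¹ x y ⟩
    x⁻¹ * (x * y)  ≈⟨ *-congˡ xy≈0 ⟩
    x⁻¹ * 0#       ≈⟨ zeroʳ x⁻¹ ⟩
    0#             ∎

  1≤x⇒xy≤0⇒y≤0 : ∀ {x y} → 1# ≤ℝ x → x * y ≤ℝ 0# → y ≤ℝ 0#
  1≤x⇒xy≤0⇒y≤0 {x} {y} 1≤x xy≤0 with total 0# y
  ... | inj₂ y≤0 = y≤0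
  ... | inj₁ 0≤y =
    ≤-reflexive (x≉0⇒xy≈0⇒y≈0 (1≤x⇒x≉0 1≤x) (antisym xy≤0 (*-nonneg x y (≤-trans 0≤1 1≤x) 0≤y)))

  +-monoˡ-≤ : ∀ x {y z} → y ≤ℝ z → x + y ≤ℝ x + z
  +-monoˡ-≤ x {y} {z} y≤z = begin
    x + y  ≈⟨ +-comm x y ⟩
    y + x  ≤⟨ +-mono y z x y≤z ⟩
    z + x  ≈⟨ +-comm z x ⟩
    x + z  ∎

  +-mono-≤ : ∀ {x y u v} → x ≤ℝ y → u ≤ℝ v → x + u ≤ℝ y + v
  +-mono-≤ {x} {y} {u} {v} x≤y u≤v = ≤-trans (+-mono x y u x≤y) (+-monoˡ-≤ y u≤v)

  sum-zero : ∀ {k} {f : Fin k → Carrier} → (∀ t → f t ≈ 0#) → sum f ≈ 0#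
  sum-zero {k} f≈0 = trans (sum-cong-≋ f≈0) (sum-replicate-zero k)

  sum-neg : ∀ {k} (f : Fin k → Carrier) → sum (λ t → - f t) ≈ - sum f
  sum-neg f = begin-equality
    sum (λ t → - f t)       ≈⟨ sum-cong-≋ (λ t → -1*x≈-x (f t)) ⟨
    sum (λ t → - 1# * f t)  ≈⟨ *-distribˡ-sum (- 1#) f ⟨
    - 1# * sum f            ≈⟨ -1*x≈-x (sum f) ⟩
    - sum f                 ∎

  sum-single : ∀ {k} {f : Fin k → Carrier} u → (∀ t → t ≢ u → f t ≈ 0#) → sum f ≈ f u
  sum-single {suc k} {f} u f≈0 = begin-equality
    sum f                     ≈⟨ sum-remove {i = u} f ⟩
    f u + sum (removeAt f u)  ≈⟨ +-congˡ (sum-zero λ j → f≈0 _ (Finₚ.punchInᵢ≢i u j)) ⟩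
    f u + 0#                  ≈⟨ +-identityʳ (f u) ⟩
    f u                       ∎

  sum-update : ∀ {k} {f g : Fin k → Carrier} u → (∀ t → t ≢ u → f t ≈ g t) → sum f + g u ≈ sum g + f u
  sum-update {suc k} {f} {g} u f≈g = begin-equality
    sum f + g u                     ≈⟨ +-congʳ (sum-remove {i = u} f) ⟩
    f u + sum (removeAt f u) + g u  ≈⟨ +-congʳ (+-congˡ (sum-cong-≋ λ j → f≈g _ (Finₚ.punchInᵢ≢i u j))) ⟩
    f u + sum (removeAt g u) + g u  ≈⟨ xy∙z≈zy∙x (f u) _ (g u) ⟩
    g u + sum (removeAt g u) + f u  ≈⟨ +-congʳ (sum-remove {i = u} g) ⟨
    sum g + f u                     ∎

  sum-mono : ∀ {k} {f g : Fin k → Carrier} → (∀ t → f t ≤ℝ g t) → sum f ≤ℝ sum g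
  sum-mono {zero}  _   = ≤-refl
  sum-mono {suc k} f≤g = +-mono-≤ (f≤g zero) (sum-mono (f≤g ∘ suc))

  sum-nonneg : ∀ {k} {f : Fin k → Carrier} → (∀ t → 0# ≤ℝ f t) → 0# ≤ℝ sum f
  sum-nonneg {k} {f} 0≤f = begin
    0#               ≈⟨ sum-replicate-zero k ⟨
    sum {k} (λ _ → 0#)   ≤⟨ sum-mono 0≤f ⟩
    sum f            ∎

  nonneg⇒≤sum : ∀ {k} {f : Fin k → Carrier} → (∀ t → 0# ≤ℝ f t) → ∀ u → f u ≤ℝ sum f
  nonneg⇒≤sum {suc k} {f} 0≤f u = begin
    f u                       ≈⟨ +-identityʳ (f u) ⟨
    f u + 0#                  ≤⟨ +-monoˡ-≤ (f u) (sum-nonneg {f = removeAt f u} (0≤f ∘ _)) ⟩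
    f u + sum (removeAt f u)  ≈⟨ sum-remove {i = u} f ⟨
    sum f                     ∎

  nonneg∧sum≈0⇒≈0 : ∀ {k} {f : Fin k → Carrier} → (∀ t → 0# ≤ℝ f t) → sum f ≈ 0# →
                    ∀ u → f u ≈ 0#
  nonneg∧sum≈0⇒≈0 {f = f} 0≤f sum≈0 u =
    antisym (begin f u ≤⟨ nonneg⇒≤sum 0≤f u ⟩ sum f ≈⟨ sum≈0 ⟩ 0# ∎) (0≤f u)

  totalOrder : TotalOrder _ _ _
  totalOrder = record { isTotalOrder = isTotalOrder }

  maximum : ∀ {k} {P : Pred (Fin k) 0ℓ} → Decidable P → (z : Fin k → Carrier) → ∀ {v} → P v →
            ∃ λ u → P u × (∀ t → P t → z t ≤ℝ z u)
  maximum {k} P? z {v} Pv =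
    argmax z v candidates ,
    argmax-all z Pv (all-filter P? (allFin k)) ,
    λ t Pt → All.lookup (f[xs]≤f[argmax] v candidates) (∈-filter⁺ P? (∈-allFin t) Pt)
    where
    open import Data.List.Extrema totalOrder using (argmax; argmax-all; f[xs]≤f[argmax])
    candidates = filter P? (allFin k)

  Balanced : ∀ {k} → (Fin k → Fin k → Carrier) → (Fin k → Carrier) → (Fin k → Carrier) → Set
  Balanced W d x = ∀ u → sum (λ t → W u t * x t) ≈ d u * x u

  Balanced-neg : ∀ {k} {W d} {x : Fin k → Carrier} → Balanced W d x → Balanced W d (λ t → - x t)
  Balanced-neg {W = W} {d} {x} balanced u = begin-equality
    sum (λ t → W u t * - x t)     ≈⟨ sum-cong-≋ (λ t → -‿distribʳ-* (W u t) (x t)) ⟨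
    sum (λ t → - (W u t * x t))   ≈⟨ sum-neg (λ t → W u t * x t) ⟩
    - sum (λ t → W u t * x t)     ≈⟨ -‿cong (balanced u) ⟩
    - (d u * x u)                 ≈⟨ -‿distribʳ-* (d u) (x u) ⟩
    d u * - x u                   ∎

  -- below t says that M bounds x t wherever the weight w t is positive.
  module MaximumPrinciple {k} (w x : Fin k → Carrier) (M : Carrier)
                          (below : ∀ t → 0# ≤ℝ w t * (M - x t)) where

    slack : sum (λ t → w t * (M - x t)) ≈ sum w * M - sum (λ t → w t * x t)
    slack = begin-equality
      sum (λ t → w t * (M - x t))
        ≈⟨ sum-cong-≋ (λ t → x[y-z]≈xy-xz (w t) M (x t)) ⟩
      sum (λ t → w t * M - w t * x t)
        ≈⟨ ∑-distrib-+ (λ t → w t * M) (λ t → - (w t * x t)) ⟩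
      sum (λ t → w t * M) + sum (λ t → - (w t * x t))
        ≈⟨ +-cong (sym (*-distribʳ-sum M w)) (sum-neg (λ t → w t * x t)) ⟩
      sum w * M - sum (λ t → w t * x t)
        ∎

    with-excess : ∀ e → 1# ≤ℝ e → sum (λ t → w t * x t) ≈ (sum w + e) * M → M ≤ℝ 0#
    with-excess e 1≤e balance = 1≤x⇒xy≤0⇒y≤0 1≤e (0≤-x⇒x≤0 (begin
      0#                                  ≤⟨ sum-nonneg below ⟩
      sum (λ t → w t * (M - x t))         ≈⟨ slack ⟩
      sum w * M - sum (λ t → w t * x t)   ≈⟨ +-congˡ (-‿cong (trans balance (distribʳ M (sum w) e))) ⟩
      sum w * M - (sum w * M + e * M)     ≈⟨ ⁻¹-anti-homo‿- (sum w * M + e * M) (sum w * M) ⟨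
      - (sum w * M + e * M - sum w * M)   ≈⟨ -‿cong (xyx⁻¹≈y (sum w * M) (e * M)) ⟩
      - (e * M)                           ∎))

    without-excess : sum (λ t → w t * x t) ≈ sum w * M → ∀ t → w t * (M - x t) ≈ 0#
    without-excess balance = nonneg∧sum≈0⇒≈0 below (begin-equality
      sum (λ t → w t * (M - x t))         ≈⟨ slack ⟩
      sum w * M - sum (λ t → w t * x t)   ≈⟨ +-congˡ (-‿cong balance) ⟩
      sum w * M - sum w * M               ≈⟨ -‿inverseʳ (sum w * M) ⟩
      0#                                  ∎)

-- Matrices of a digraph

module KernelFacts (ℝ : RealNumbers) where
  open RealNumbers ℝ hiding (zero; _≤ℝ_)
  open Matrices ℝ
  open OrderedField ℝ

  sumFin≈sum : ∀ {k} (f : Fin k → Carrier) → sumFin f ≈ sum f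
  sumFin≈sum {zero}  f = refl
  sumFin≈sum {suc k} f = +-congˡ (sumFin≈sum (f ∘ suc))

  kernel-row : ∀ {k} {B : Matrix k} {x} → InKernel B x → ∀ u → sum (λ t → B u t * x t) ≈ 0#
  kernel-row {B = B} {x} Bx≈0 u = trans (sym (sumFin≈sum (λ t → B u t * x t))) (Bx≈0 u)

  TrivialKernel : ∀ {k} → Matrix k → Set
  TrivialKernel B = ∀ x → InKernel B x → ∀ u → x u ≈ 0#

  trivialKernel⇒ASAP : ∀ {k} {B : Matrix k} → TrivialKernel B → ASAP B
  trivialKernel⇒ASAP trivial X _ _ BXᵀ≈0 w = trivial (X w) (λ u → BXᵀ≈0 u w)

  trivialKernel⇒nullity0 : ∀ {k} {B : Matrix k} → TrivialKernel B → HasNullity B 0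
  trivialKernel⇒nullity0 trivial = (λ ()) , (λ ()) , (λ _ _ ()) , λ x Bx≈0 → (λ ()) , trivial x Bx≈0

  trivialKernel⇒nullity≤0 : ∀ {k d} {B : Matrix k} → TrivialKernel B → HasNullity B d → d ≤ 0
  trivialKernel⇒nullity≤0 {d = zero}  _       _                      = z≤n
  trivialKernel⇒nullity≤0 {d = suc d} trivial (v , Bv≈0 , indep , _) =
    contradiction (sym (indep e₀ e₀·v≈0 zero)) 0≉1
    where
    e₀ : Fin (suc d) → Carrier
    e₀ zero    = 1#
    e₀ (suc _) = 0#

    e₀·v≈0 : ∀ u → lincomb e₀ v u ≈ 0#
    e₀·v≈0 u = begin-equality
      1# * v zero u + sumFin rest  ≈⟨ +-cong (*-identityˡ _) (trans (sumFin≈sum rest) (sum-zero {f = rest} λ i → zeroˡ _)) ⟩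
      v zero u + 0#                ≈⟨ +-identityʳ _ ⟩
      v zero u                     ≈⟨ trivial (v zero) (Bv≈0 zero) u ⟩
      0#                           ∎
      where
      rest : Fin d → Carrier
      rest i = 0# * v (suc i) u

module DigraphMatrices (ℝ : RealNumbers) (D : Digraph) where
  open RealNumbers ℝ hiding (zero; _≤ℝ_)
  open Matrices ℝ
  open OrderedField ℝ
  open KernelFacts ℝ
  open Walks (arc D)

  𝟙 : Bool → Carrier
  𝟙 true  = 1#
  𝟙 false = 0#

  𝟙-nonneg : ∀ b → 0# ≤ℝ 𝟙 b
  𝟙-nonneg true  = 0≤1
  𝟙-nonneg false = ≤-refl

  adjacency : Matrix (n D)
  adjacency u t = 𝟙 (arc D u t)

  adjacency-nonneg : ∀ u t → 0# ≤ℝ adjacency u t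
  adjacency-nonneg u t = 𝟙-nonneg (arc D u t)

  adjacency-arc : ∀ {u t} → u ⟶ t → adjacency u t ≈ 1#
  adjacency-arc u⟶t = reflexive (≡.cong 𝟙 u⟶t)

  adjacency-nonArc : ∀ {u t} → arc D u t ≡ false → adjacency u t ≈ 0#
  adjacency-nonArc u↛t = reflexive (≡.cong 𝟙 u↛t)

  adjacency-diag : ∀ u → adjacency u u ≈ 0#
  adjacency-diag u = adjacency-nonArc (loopless D u)

  withDiagonal : (Fin (n D) → Carrier) → Matrix (n D)
  withDiagonal δ u t = if does (u ≟ t) then δ u else adjacency u t

  module _ (δ : Fin (n D) → Carrier) where

    withDiagonal-diag : ∀ u → withDiagonal δ u u ≈ δ u
    withDiagonal-diag u = reflexive (≡.cong (if_then δ u else adjacency u u) (dec-true (u ≟ u) ≡.refl))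

    withDiagonal-off : ∀ {u t} → u ≢ t → withDiagonal δ u t ≈ adjacency u t
    withDiagonal-off {u} {t} u≢t = reflexive (≡.cong (if_then δ u else adjacency u t) (dec-false (u ≟ t) u≢t))

    withDiagonal∈Q : (∀ u → ¬ δ u ≈ 0#) → InQ D (withDiagonal δ)
    withDiagonal∈Q δ≉0 =
      (λ u → δ≉0 u ∘ trans (sym (withDiagonal-diag u))) ,
      (λ u w u≢w u⟶w B≈0 → 0≉1 (trans (sym B≈0) (trans (withDiagonal-off u≢w) (adjacency-arc u⟶w)))) ,
      (λ u w u≢w u↛w → trans (withDiagonal-off u≢w) (adjacency-nonArc u↛w))

    withDiagonal-row : ∀ u (x : Fin (n D) → Carrier) →
                       sum (λ t → withDiagonal δ u t * x t) ≈ sum (λ t → adjacency u t * x t) + δ u * x u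
    withDiagonal-row u x = begin-equality
      sum (λ t → withDiagonal δ u t * x t)
        ≈⟨ +-identityʳ _ ⟨
      sum (λ t → withDiagonal δ u t * x t) + 0#
        ≈⟨ +-congˡ (trans (*-congʳ (adjacency-diag u)) (zeroˡ (x u))) ⟨
      sum (λ t → withDiagonal δ u t * x t) + adjacency u u * x u
        ≈⟨ sum-update u (λ t t≢u → *-congʳ (withDiagonal-off (t≢u ∘ ≡.sym))) ⟩
      sum (λ t → adjacency u t * x t) + withDiagonal δ u u * x u
        ≈⟨ +-congˡ (*-congʳ (withDiagonal-diag u)) ⟩
      sum (λ t → adjacency u t * x t) + δ u * x u
        ∎

    withDiagonal-col : ∀ w (y : Fin (n D) → Carrier) →
                       sum (λ t → y t * withDiagonal δ t w) ≈ sum (λ t → y t * adjacency t w) + y w * δ w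
    withDiagonal-col w y = begin-equality
      sum (λ t → y t * withDiagonal δ t w)
        ≈⟨ +-identityʳ _ ⟨
      sum (λ t → y t * withDiagonal δ t w) + 0#
        ≈⟨ +-congˡ (trans (*-congˡ (adjacency-diag w)) (zeroʳ (y w))) ⟨
      sum (λ t → y t * withDiagonal δ t w) + y w * adjacency w w
        ≈⟨ sum-update w (λ t t≢w → *-congˡ (withDiagonal-off t≢w)) ⟩
      sum (λ t → y t * adjacency t w) + y w * withDiagonal δ w w
        ≈⟨ +-congˡ (*-congˡ (withDiagonal-diag w)) ⟩
      sum (λ t → y t * adjacency t w) + y w * δ w
        ∎

  acyclic⇒trivialKernel : ∀ {B} → Acyclic D → InQ D B → TrivialKernel B
  acyclic⇒trivialKernel {B} acyclic (diag≉0 , _ , nonArc≈0) x Bx≈0 u = vanish u (acyclic⇒wellFounded acyclic u)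
    where
    -- Induction from the sinks: row u of Bx = 0 involves only x u and the x t with u ⟶ t.
    vanish : ∀ u → Acc (flip _⟶_) u → x u ≈ 0#
    vanish u (acc rec) = x≉0⇒xy≈0⇒y≈0 (diag≉0 u) (begin-equality
      B u u * x u              ≈⟨ sum-single u offDiagonal ⟨
      sum (λ t → B u t * x t)  ≈⟨ kernel-row Bx≈0 u ⟩
      0#                       ∎)
      where
      offDiagonal : ∀ t → t ≢ u → B u t * x t ≈ 0#
      offDiagonal t t≢u with arc D u t in u→t
      ... | true  = trans (*-congˡ (vanish t (rec u→t))) (zeroʳ _)
      ... | false = trans (*-congʳ (nonArc≈0 u t (t≢u ∘ ≡.sym) u→t)) (zeroˡ _)

  acyclic⇒ν⃗≡0 : Acyclic D → NuArrow D 0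
  acyclic⇒ν⃗≡0 acyclic =
    (I+A , I+A∈Q , trivialKernel⇒ASAP trivial , trivialKernel⇒nullity0 trivial) ,
    λ B _ B∈Q _ → trivialKernel⇒nullity≤0 (acyclic⇒trivialKernel acyclic B∈Q)
    where
    I+A = withDiagonal (λ _ → 1#)
    I+A∈Q = withDiagonal∈Q _ (λ _ → 0≉1 ∘ sym)
    trivial = acyclic⇒trivialKernel acyclic I+A∈Q

-- A matrix of nullity one for a digraph with a cycle

module CycleMatrix (ℝ : RealNumbers) (D : Digraph) {f g : Fin (n D)}
                   (f⟶g : Walks._⟶_ (arc D) f g) (g⇝f : Walks._⇝_ (arc D) g f)
                   (reach? : ∀ u → Dec (Walks._⇝_ (arc D) u f)) where
  open RealNumbers ℝ hiding (zero; _≤ℝ_)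
  open Matrices ℝ
  open OrderedField ℝ
  open KernelFacts ℝ
  open DigraphMatrices ℝ D
  open Walks (arc D)
  open import Algebra.Properties.Ring ring
    using (-0#≈0#; -‿involutive; -‿distribˡ-*; -‿distribʳ-*; x∙y⁻¹≈ε⇒x≈y; x≈y⇒x∙y⁻¹≈ε)
  open import Algebra.Properties.CommutativeSemigroup +-commutativeSemigroup using (x∙yz≈y∙xz)

  A : Matrix (n D)
  A = adjacency

  χ : Fin (n D) → Carrier
  χ u = 𝟙 (does (reach? u))

  reachOut out inn : Fin (n D) → Carrier
  reachOut u = sum (λ t → A u t * χ t)
  out u      = sum (A u)
  inn u      = sum (λ t → A t u)

  d : Fin (n D) → Carrier
  d u = if does (reach? u) then reachOut u else out u + (inn u + 1#)

  B : Matrix (n D)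
  B = withDiagonal (λ u → - d u)

  reach-step : ∀ {u} → u ⇝ f → ∃ λ t → u ⟶ t × t ⇝ f
  reach-step ε           = g , f⟶g , g⇝f
  reach-step (u⟶t ◅ t⇝f) = _ , u⟶t , t⇝f

  χ-reach : ∀ {u} → u ⇝ f → χ u ≈ 1#
  χ-reach {u} r with reach? u
  ... | yes _ = refl
  ... | no ¬r = contradiction r ¬r

  χ-unreach : ∀ {u} → ¬ u ⇝ f → χ u ≈ 0#
  χ-unreach {u} ¬r with reach? u
  ... | yes r = contradiction r ¬r
  ... | no _  = refl

  d-reach : ∀ {u} → u ⇝ f → d u ≈ reachOut u
  d-reach {u} r with reach? u
  ... | yes _ = refl
  ... | no ¬r = contradiction r ¬r

  d-unreach : ∀ {u} → ¬ u ⇝ f → d u ≈ out u + (inn u + 1#)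
  d-unreach {u} ¬r with reach? u
  ... | yes r = contradiction r ¬r
  ... | no _  = refl

  reachWeight-nonneg : ∀ u t → 0# ≤ℝ A u t * χ t
  reachWeight-nonneg u t = *-nonneg _ _ (adjacency-nonneg u t) (𝟙-nonneg (does (reach? t)))

  1≤d : ∀ u → 1# ≤ℝ d u
  1≤d u with reach? u
  ... | yes r = let t , u⟶t , t⇝f = reach-step r in begin
    1#             ≈⟨ *-identityˡ 1# ⟨
    1# * 1#        ≈⟨ *-cong (adjacency-arc u⟶t) (χ-reach t⇝f) ⟨
    A u t * χ t    ≤⟨ nonneg⇒≤sum (reachWeight-nonneg u) t ⟩
    reachOut u     ∎
  ... | no _ = ≤-trans (0≤x⇒y≤x+y 1# (sum-nonneg λ t → adjacency-nonneg t u))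
                       (0≤x⇒y≤x+y _ (sum-nonneg (adjacency-nonneg u)))

  B∈Q : InQ D B
  B∈Q = withDiagonal∈Q _ λ u -d≈0 → 1≤x⇒x≉0 (1≤d u) (begin-equality
    d u        ≈⟨ -‿involutive (d u) ⟨
    - (- d u)  ≈⟨ -‿cong -d≈0 ⟩
    - 0#       ≈⟨ -0#≈0# ⟩
    0#         ∎)

  kernel⇒balanced : ∀ {x} → InKernel B x → Balanced A d x
  kernel⇒balanced {x} Bx≈0 u = x∙y⁻¹≈ε⇒x≈y _ _ (begin-equality
    sum (λ t → A u t * x t) - d u * x u     ≈⟨ +-congˡ (-‿distribˡ-* (d u) (x u)) ⟩
    sum (λ t → A u t * x t) + - d u * x u   ≈⟨ withDiagonal-row (λ v → - d v) u x ⟨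
    sum (λ t → B u t * x t)                 ≈⟨ kernel-row Bx≈0 u ⟩
    0#                                      ∎)

  balanced⇒kernel : ∀ {x} → Balanced A d x → InKernel B x
  balanced⇒kernel {x} balanced u = trans (sumFin≈sum (λ t → B u t * x t)) (begin-equality
    sum (λ t → B u t * x t)                 ≈⟨ withDiagonal-row (λ v → - d v) u x ⟩
    sum (λ t → A u t * x t) + - d u * x u   ≈⟨ +-congˡ (-‿distribˡ-* (d u) (x u)) ⟨
    sum (λ t → A u t * x t) - d u * x u     ≈⟨ x≈y⇒x∙y⁻¹≈ε (balanced u) ⟩
    0#                                      ∎)

  leftKernel⇒balanced : ∀ {y} → (∀ w → sumFin (λ t → y t * B t w) ≈ 0#) → Balanced (flip A) d y
  leftKernel⇒balanced {y} yB≈0 w = begin-equality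
    sum (λ t → A t w * y t)   ≈⟨ sum-cong-≋ (λ t → *-comm (A t w) (y t)) ⟩
    sum (λ t → y t * A t w)   ≈⟨ x∙y⁻¹≈ε⇒x≈y _ _ yA-yd≈0 ⟩
    y w * d w                 ≈⟨ *-comm (y w) (d w) ⟩
    d w * y w                 ∎
    where
    yA-yd≈0 : sum (λ t → y t * A t w) - y w * d w ≈ 0#
    yA-yd≈0 = begin-equality
      sum (λ t → y t * A t w) - y w * d w     ≈⟨ +-congˡ (-‿distribʳ-* (y w) (d w)) ⟩
      sum (λ t → y t * A t w) + y w * - d w   ≈⟨ withDiagonal-col (λ v → - d v) w y ⟨
      sum (λ t → y t * B t w)                 ≈⟨ sumFin≈sum (λ t → y t * B t w) ⟨
      sumFin (λ t → y t * B t w)              ≈⟨ yB≈0 w ⟩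
      0#                                      ∎

  χ-balanced : Balanced A d χ
  χ-balanced u with reach? u
  ... | yes _ = sym (*-identityʳ (reachOut u))
  ... | no ¬r = begin-equality
    reachOut u               ≈⟨ sum-zero noReachingArc ⟩
    0#                       ≈⟨ zeroʳ _ ⟨
    (out u + (inn u + 1#)) * 0#  ∎
    where
    noReachingArc : ∀ t → A u t * χ t ≈ 0#
    noReachingArc t with arc D u t in u→t
    ... | true  = trans (*-identityˡ (χ t)) (χ-unreach (¬r ∘ (u→t ◅_)))
    ... | false = zeroˡ (χ t)

  balanced⇒≤0-unreaching : ∀ {x} → Balanced A d x → ∀ {v} → ¬ v ⇝ f → x v ≤ℝ 0#
  balanced⇒≤0-unreaching {x} balanced {v} ¬rᵥ with maximum (¬? ∘ reach?) x ¬rᵥ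
  ... | u , ¬rᵤ , max = ≤-trans (max v ¬rᵥ)
    (MaximumPrinciple.with-excess (A u) x (x u) below (inn u + 1#)
      (0≤x⇒y≤x+y 1# (sum-nonneg λ t → adjacency-nonneg t u)) (trans (balanced u) (*-congʳ (d-unreach ¬rᵤ))))
    where
    below : ∀ t → 0# ≤ℝ A u t * (x u - x t)
    below t with arc D u t in u→t
    ... | true  = *-nonneg _ _ 0≤1 (x≤y⇒0≤y-x (max t (¬rᵤ ∘ (u→t ◅_))))
    ... | false = ≤-reflexive (sym (zeroˡ _))

  balanced⇒≈0-unreaching : ∀ {x} → Balanced A d x → ∀ {v} → ¬ v ⇝ f → x v ≈ 0#
  balanced⇒≈0-unreaching balanced ¬r =
    antisym (balanced⇒≤0-unreaching balanced ¬r)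
            (-x≤0⇒0≤x (balanced⇒≤0-unreaching (Balanced-neg balanced) ¬r))

  balanced⇒≤-reaching : ∀ {x} → Balanced A d x → ∀ {v} → v ⇝ f → x v ≤ℝ x f
  balanced⇒≤-reaching {x} balanced {v} rᵥ with maximum reach? x {f} ε
  ... | u , rᵤ , max = begin
    x v   ≤⟨ max v rᵥ ⟩
    x u   ≈⟨ propagate rᵤ refl ⟨
    x f   ∎
    where
    M = x u

    step : ∀ {a c} → a ⟶ c → c ⇝ f → x a ≈ M → x c ≈ M
    step {a} {c} a⟶c c⇝f xₐ≈M = sym (x∙y⁻¹≈ε⇒x≈y M (x c) (begin-equality
      M - x c                        ≈⟨ *-identityˡ _ ⟨
      1# * (M - x c)                 ≈⟨ *-congʳ (trans (*-cong (adjacency-arc a⟶c) (χ-reach c⇝f)) (*-identityˡ 1#)) ⟨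
      (A a c * χ c) * (M - x c)      ≈⟨ MaximumPrinciple.without-excess (λ t → A a t * χ t) x M below balanceₐ c ⟩
      0#                             ∎))
      where
      below : ∀ t → 0# ≤ℝ (A a t * χ t) * (M - x t)
      below t with reach? t
      ... | yes r = *-nonneg _ _ (*-nonneg _ _ (adjacency-nonneg a t) 0≤1) (x≤y⇒0≤y-x (max t r))
      ... | no _  = ≤-reflexive (sym (trans (*-congʳ (zeroʳ (A a t))) (zeroˡ _)))

      x≈χx : ∀ t → x t ≈ χ t * x t
      x≈χx t with reach? t
      ... | yes _ = sym (*-identityˡ (x t))
      ... | no ¬r = trans (balanced⇒≈0-unreaching balanced ¬r) (sym (zeroˡ (x t)))

      balanceₐ : sum (λ t → (A a t * χ t) * x t) ≈ reachOut a * M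
      balanceₐ = begin-equality
        sum (λ t → (A a t * χ t) * x t)   ≈⟨ sum-cong-≋ (λ t → trans (*-assoc _ _ _) (*-congˡ (sym (x≈χx t)))) ⟩
        sum (λ t → A a t * x t)           ≈⟨ balanced a ⟩
        d a * x a                         ≈⟨ *-cong (d-reach (a⟶c ◅ c⇝f)) xₐ≈M ⟩
        reachOut a * M                    ∎

    propagate : ∀ {a} → a ⇝ f → x a ≈ M → x f ≈ M
    propagate ε             x≈M = x≈M
    propagate (a⟶c ◅ c⇝f) xₐ≈M = propagate c⇝f (step a⟶c c⇝f xₐ≈M)

  balanced⇒≈-reaching : ∀ {x} → Balanced A d x → ∀ {v} → v ⇝ f → x v ≈ x f
  balanced⇒≈-reaching balanced r =
    antisym (balanced⇒≤-reaching balanced r) (neg-reflects (balanced⇒≤-reaching (Balanced-neg balanced) r))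

  balanced⇒∝χ : ∀ {x} → Balanced A d x → ∀ t → x t ≈ x f * χ t
  balanced⇒∝χ {x} balanced t with reach? t
  ... | yes r = trans (balanced⇒≈-reaching balanced r) (sym (*-identityʳ (x f)))
  ... | no ¬r = trans (balanced⇒≈0-unreaching balanced ¬r) (sym (zeroʳ (x f)))

  coBalanced⇒≤0 : ∀ {y} → Balanced (flip A) d y → (∀ {t} → t ⇝ f → y t ≈ 0#) → ∀ v → y v ≤ℝ 0#
  coBalanced⇒≤0 {y} balanced y≈0 v with maximum (λ _ → yes tt) y {v} tt
  ... | u , _ , max = ≤-trans (max v tt) (atMaximum (reach? u))
    where
    atMaximum : Dec (u ⇝ f) → y u ≤ℝ 0#
    atMaximum (yes r)  = ≤-reflexive (y≈0 r)
    atMaximum (no ¬r) = MaximumPrinciple.with-excess (λ t → A t u) y (y u)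
      (λ t → *-nonneg _ _ (adjacency-nonneg t u) (x≤y⇒0≤y-x (max t tt))) (out u + 1#)
      (0≤x⇒y≤x+y 1# (sum-nonneg (adjacency-nonneg u)))
      (trans (balanced u) (*-congʳ (trans (d-unreach ¬r) (x∙yz≈y∙xz (out u) (inn u) 1#))))

  coBalanced⇒≈0 : ∀ {y} → Balanced (flip A) d y → (∀ {t} → t ⇝ f → y t ≈ 0#) → ∀ v → y v ≈ 0#
  coBalanced⇒≈0 balanced y≈0 v = antisym (coBalanced⇒≤0 balanced y≈0 v)
    (-x≤0⇒0≤x (coBalanced⇒≤0 (Balanced-neg balanced) (λ r → trans (-‿cong (y≈0 r)) -0#≈0#) v))

  B-ASAP : ASAP B
  B-ASAP X X∘B≈0 XᵀB≈0 BXᵀ≈0 t w = begin-equality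
    X t w          ≈⟨ balanced⇒∝χ (kernel⇒balanced (λ u → BXᵀ≈0 u t)) w ⟩
    X t f * χ w    ≈⟨ *-congʳ (coBalanced⇒≈0 (leftKernel⇒balanced (XᵀB≈0 f)) Xf≈0-reaching t) ⟩
    0# * χ w       ≈⟨ zeroˡ (χ w) ⟩
    0#             ∎
    where
    Xf≈0-reaching : ∀ {s} → s ⇝ f → X s f ≈ 0#
    Xf≈0-reaching {s} r = begin-equality
      X s f          ≈⟨ *-identityʳ (X s f) ⟨
      X s f * 1#     ≈⟨ *-congˡ (χ-reach r) ⟨
      X s f * χ s    ≈⟨ balanced⇒∝χ (kernel⇒balanced (λ u → BXᵀ≈0 u s)) s ⟨
      X s s          ≈⟨ x≉0⇒xy≈0⇒y≈0 (proj₁ B∈Q s) (trans (*-comm (B s s) (X s s)) (X∘B≈0 s s)) ⟩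
      0#             ∎

  B-nullity1 : HasNullity B 1
  B-nullity1 = (λ _ → χ) , (λ _ → balanced⇒kernel χ-balanced) , independent , spanning
    where
    independent : ∀ c → (∀ u → lincomb c (λ _ → χ) u ≈ 0#) → ∀ i → c i ≈ 0#
    independent c cχ≈0 zero = begin-equality
      c zero                ≈⟨ *-identityʳ (c zero) ⟨
      c zero * 1#           ≈⟨ *-congˡ (χ-reach ε) ⟨
      c zero * χ f          ≈⟨ +-identityʳ _ ⟨
      c zero * χ f + 0#     ≈⟨ cχ≈0 f ⟩
      0#                    ∎

    spanning : ∀ x → InKernel B x → ∃ λ c → ∀ u → x u ≈ lincomb c (λ _ → χ) u
    spanning x Bx≈0 = (λ _ → x f) , λ u →
      trans (balanced⇒∝χ (kernel⇒balanced Bx≈0) u) (sym (+-identityʳ _))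

¬¬-decidable : ∀ {k} (P : Fin k → Set) → ¬ ¬ (∀ t → Dec (P t))
¬¬-decidable {zero}  P ¬dec = ¬dec λ ()
¬¬-decidable {suc k} P ¬dec =
  ¬¬-excluded-middle λ P₀? → ¬¬-decidable (P ∘ suc) λ P₊? → ¬dec λ { zero → P₀? ; (suc t) → P₊? t }

ν⃗≡0⇒acyclic : (ℝ : RealNumbers) (D : Digraph) → Matrices.NuArrow ℝ D 0 → Acyclic D
ν⃗≡0⇒acyclic ℝ D (_ , maximal) cycle =
  let a , b , a⟶b , b⇝a = cycle⇒closedWalk cycle in
  -- The goal is ⊥, so decidability of reachability may be assumed by excluded middle.
  ¬¬-decidable (_⇝ a) λ reach? →
    let open CycleMatrix ℝ D a⟶b b⇝a reach? in
    contradiction (maximal B 1 B∈Q B-ASAP B-nullity1) λ ()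
  where open Walks (arc D)

mainTheorem3 : (ℝ : RealNumbers) (D : Digraph) → 1 ≤ n D →
    let open Matrices ℝ in
    (Acyclic D ⇔ KellyWidth D 1) × (KellyWidth D 1 ⇔ NuArrow D 0)
mainTheorem3 ℝ D 1≤n =
  mk⇔ (acyclic⇒kellyWidth≡1 D 1≤n) (kellyWidth≡1⇒acyclic D) ,
  mk⇔ (DigraphMatrices.acyclic⇒ν⃗≡0 ℝ D ∘ kellyWidth≡1⇒acyclic D)
      (acyclic⇒kellyWidth≡1 D 1≤n ∘ ν⃗≡0⇒acyclic ℝ D)
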